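{- For every integer $L\geq 2$, the power series \[ H_{L,1}(q):=\frac{q}{(q;q)_{L-1}(1-q^{L+1})}-\left(\frac{1}{(q^2;q)_L}-1\right) \] has all coefficients non-negative.
   Context: $(a;q)_n=\prod_{i=0}^{n-1}(1-aq^i)$; all expressions are expanded as formal power series in $q$. -}

module Defs where

open import Data.Nat as ℕ using (ℕ; zero; suc; _∸_)
open import Data.Nat.Divisibility using (_∣?_)
open import Data.Integer using (ℤ; 0ℤ; 1ℤ; _+_; _-_; _*_; _≤_)
open import Relation.Nullary using (yes; no)

-- Formal power series in q with integer coefficients: n ↦ [q^n] f.
Series : Set
Series = ℕ → ℤ

convSum : Series → Series → ℕ → ℕ → ℤ
convSum f g n zero    = f 0 * g n
convSum f g n (suc k) = convSum f g n k + f (suc k) * g (n ∸ suc k)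

_⊛_ : Series → Series → Series
(f ⊛ g) n = convSum f g n n

_⊖_ : Series → Series → Series
(f ⊖ g) n = f n - g n

one : Series
one zero    = 1ℤ
one (suc _) = 0ℤ

qser : Series
qser zero          = 0ℤ
qser (suc zero)    = 1ℤ
qser (suc (suc _)) = 0ℤ

-- 1 / (1 - q^(suc m)), expanded as the geometric series Σ_j q^{(m+1) j}:
-- the coefficient of q^n is 1 if (m+1) ∣ n and 0 otherwise.
geom : ℕ → Series
geom m n with suc m ∣? n
... | yes _ = 1ℤ
... | no  _ = 0ℤ

prodSeries : ℕ → (ℕ → Series) → Series
prodSeries zero    F = one
prodSeries (suc k) F = prodSeries k F ⊛ F k

-- 1/(q;q)_n = ∏_{i=0}^{n-1} 1/(1 - q^{i+1})
invQPoch : ℕ → Series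
invQPoch n = prodSeries n (λ i → geom i)

-- 1/(q^2;q)_n = ∏_{i=0}^{n-1} 1/(1 - q^{i+2})
invQ2Poch : ℕ → Series
invQ2Poch n = prodSeries n (λ i → geom (suc i))

H : ℕ → Series
H L = (qser ⊛ (invQPoch (L ∸ 1) ⊛ geom L)) ⊖ (invQ2Poch L ⊖ one)

module Submission where

-- Write P_k = 1/(q;q)_k and Q_k = 1/(q^2;q)_k, and put L = l + 2.  Then
-- [q^0] H_{L,1} = 0 and [q^(m+1)] H_{L,1} = [q^m] (P_{l+1} / (1 - q^(l+3))) - [q^(m+1)] Q_{l+2},
-- so the theorem says  Q_{l+2}(m+1) ≤ (P_{l+1}/(1-q^(l+3)))(m)  for all m.
--
-- The only analytic tool is the recurrence for a geometric factor: if
-- Y = X/(1-q^s) then Y = X + q^s Y, i.e. Y(n) = X(n) for n < s and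
-- Y(p+s) = X(p+s) + Y(p).

open import Defs
open import Data.Nat using (ℕ; _≤_)
open import Data.Integer using (0ℤ) renaming (_≤_ to _≤ℤ_)

import Data.Nat as ℕ
open import Data.Nat using (zero; suc; _∸_; _<_; _≤?_; _≤′_; ≤′-refl; ≤′-step; z≤n; s≤s)
open import Data.Nat.Properties
  using (≰⇒>; m∸n+n≡m; m∸n≤m; ≤-<-trans; +-∸-comm; +-∸-assoc; m<n+o⇒m∸n<o; +-monoˡ-<;
         +-suc; m<m+n; m≤′m+n; ≤′⇒≤; z≤′n; s≤′s; m<1+n⇒m<n∨m≡n;
         <⇒≱; <⇒≤; m+n∸n≡m; m≤n+m; ≤-refl; m≤n⇒m≤1+n; n∸n≡0; +-comm)
open import Data.Nat.Divisibility using (_∣_; _∣?_; ∣⇒≤; ∣m+n∣m⇒∣n; ∣m∣n⇒∣m+n; ∣-refl)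
open import Data.Nat.Induction using (<-rec)
open import Data.Integer using (1ℤ; _+_; _*_; _-_; +≤+)
open import Data.Integer.Properties
  using (+-identityˡ; +-identityʳ; *-identityˡ; *-identityʳ; *-zeroʳ; *-distribˡ-+;
         +-mono-≤; +-monoˡ-≤; +-monoʳ-≤; i≤j⇒0≤j-i; +-commutativeSemigroup; module ≤-Reasoning)
  renaming (≤-refl to ≤ℤ-refl; ≤-reflexive to ≤ℤ-reflexive; ≤-trans to ≤ℤ-trans)
open import Algebra.Properties.CommutativeSemigroup +-commutativeSemigroup using (interchange)
open import Data.Sum using (inj₁; inj₂)
open import Relation.Binary.PropositionalEquality using (_≡_; refl; sym; trans; cong; cong₂; subst; module ≡-Reasoning)
open import Relation.Nullary using (yes; no)
open import Relation.Nullary.Negation using (contradiction)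

Nonneg : Series → Set
Nonneg f = ∀ n → 0ℤ ≤ℤ f n

Nondecreasing : Series → Set
Nondecreasing f = ∀ n → f n ≤ℤ f (suc n)

one-nonneg : Nonneg one
one-nonneg zero    = +≤+ z≤n
one-nonneg (suc _) = ≤ℤ-refl

data Position (s : ℕ) : ℕ → Set where
  below : ∀ {n} → n < s → Position s n
  above : ∀ p → Position s (p ℕ.+ s)

position : ∀ s n → Position s n
position s n with s ≤? n
... | no  s≰n = below (≰⇒> s≰n)
... | yes s≤n = subst (Position s) (m∸n+n≡m s≤n) (above (n ∸ s))

p<p+s : ∀ p m → p < p ℕ.+ suc m
p<p+s p m = m<m+n p (s≤s z≤n)

shift : ℕ → Series → Series
shift s h n with s ≤? n
... | yes _ = h (n ∸ s)
... | no  _ = 0ℤ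

shift-below : ∀ s h {n} → n < s → shift s h n ≡ 0ℤ
shift-below s h {n} n<s with s ≤? n
... | yes s≤n = contradiction s≤n (<⇒≱ n<s)
... | no  _   = refl

shift-above : ∀ s h p → shift s h (p ℕ.+ s) ≡ h p
shift-above s h p with s ≤? p ℕ.+ s
... | yes _   = cong h (m+n∸n≡m p s)
... | no  s≰n = contradiction (m≤n+m s p) s≰n

shift-nonneg : ∀ s h → Nonneg h → Nonneg (shift s h)
shift-nonneg s h h≥0 n with s ≤? n
... | yes _ = h≥0 (n ∸ s)
... | no  _ = ≤ℤ-refl

convSum-congʳ : ∀ X {g g'} → (∀ a → g a ≡ g' a) → ∀ n K → convSum X g n K ≡ convSum X g' n K
convSum-congʳ X g≡g' n zero    = cong (X 0 *_) (g≡g' n)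
convSum-congʳ X g≡g' n (suc K) =
  cong₂ _+_ (convSum-congʳ X g≡g' n K) (cong (X (suc K) *_) (g≡g' (n ∸ suc K)))

convSum-distribʳ : ∀ X g h n K →
  convSum X (λ a → g a + h a) n K ≡ convSum X g n K + convSum X h n K
convSum-distribʳ X g h n zero    = *-distribˡ-+ (X 0) (g n) (h n)
convSum-distribʳ X g h n (suc K) = begin
  convSum X (λ a → g a + h a) n K + X (suc K) * (g i + h i)
    ≡⟨ cong₂ _+_ (convSum-distribʳ X g h n K) (*-distribˡ-+ (X (suc K)) (g i) (h i)) ⟩
  (convSum X g n K + convSum X h n K) + (X (suc K) * g i + X (suc K) * h i)
    ≡⟨ interchange (convSum X g n K) (convSum X h n K) (X (suc K) * g i) (X (suc K) * h i) ⟩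
  (convSum X g n K + X (suc K) * g i) + (convSum X h n K + X (suc K) * h i) ∎
  where
  open ≡-Reasoning
  i = n ∸ suc K

convSum-vanishing : ∀ X g n K → (∀ k → k ≤ K → X k * g (n ∸ k) ≡ 0ℤ) → convSum X g n K ≡ 0ℤ
convSum-vanishing X g n zero    vanish = vanish 0 z≤n
convSum-vanishing X g n (suc K) vanish =
  cong₂ _+_ (convSum-vanishing X g n K (λ k k≤K → vanish k (m≤n⇒m≤1+n k≤K))) (vanish (suc K) ≤-refl)

convSum-tail : ∀ X g n {K K'} → K ≤′ K' → (∀ k → K < k → X k * g (n ∸ k) ≡ 0ℤ) →
  convSum X g n K' ≡ convSum X g n K
convSum-tail X g n ≤′-refl                  vanish = refl
convSum-tail X g n {K} {suc K'} (≤′-step K≤K') vanish = begin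
  convSum X g n K' + X (suc K') * g (n ∸ suc K')
    ≡⟨ cong₂ _+_ (convSum-tail X g n K≤K' vanish) (vanish (suc K') (s≤s (≤′⇒≤ K≤K'))) ⟩
  convSum X g n K + 0ℤ
    ≡⟨ +-identityʳ _ ⟩
  convSum X g n K ∎
  where open ≡-Reasoning

⊛-one : ∀ X n → (X ⊛ one) n ≡ X n
⊛-one X zero    = *-identityʳ (X 0)
⊛-one X (suc n) = begin
  convSum X one (suc n) n + X (suc n) * one (suc n ∸ suc n)
    ≡⟨ cong₂ _+_ (convSum-vanishing X one (suc n) n earlier-terms)
                 (cong (λ i → X (suc n) * one i) (n∸n≡0 n)) ⟩
  0ℤ + X (suc n) * 1ℤ
    ≡⟨ trans (+-identityˡ _) (*-identityʳ (X (suc n))) ⟩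
  X (suc n) ∎
  where
  open ≡-Reasoning
  earlier-terms : ∀ k → k ≤ n → X k * one (suc n ∸ k) ≡ 0ℤ
  earlier-terms k k≤n = trans (cong (λ i → X k * one i) (+-∸-assoc 1 k≤n)) (*-zeroʳ (X k))

convSum-shift-head : ∀ X s h p K → K ≤ p → convSum X (shift s h) (p ℕ.+ s) K ≡ convSum X h p K
convSum-shift-head X s h p zero    _   = cong (X 0 *_) (shift-above s h p)
convSum-shift-head X s h p (suc K) K<p =
  cong₂ _+_ (convSum-shift-head X s h p K (<⇒≤ K<p))
            (cong (X (suc K) *_) (trans (cong (shift s h) (+-∸-comm s K<p)) (shift-above s h (p ∸ suc K))))

⊛-shift : ∀ X m h n → (X ⊛ shift (suc m) h) n ≡ shift (suc m) (X ⊛ h) n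
⊛-shift X m h n with position (suc m) n
... | below n<s = begin
  convSum X (shift (suc m) h) n n  ≡⟨ convSum-vanishing X (shift (suc m) h) n n all-vanish ⟩
  0ℤ                               ≡⟨ sym (shift-below (suc m) (X ⊛ h) n<s) ⟩
  shift (suc m) (X ⊛ h) n ∎
  where
  open ≡-Reasoning
  all-vanish : ∀ k → k ≤ n → X k * shift (suc m) h (n ∸ k) ≡ 0ℤ
  all-vanish k _ = trans (cong (X k *_) (shift-below (suc m) h (≤-<-trans (m∸n≤m n k) n<s))) (*-zeroʳ (X k))
... | above p = begin
  convSum X (shift s h) (p ℕ.+ s) (p ℕ.+ s)
    ≡⟨ convSum-tail X (shift s h) (p ℕ.+ s) (m≤′m+n p s) tail-vanish ⟩
  convSum X (shift s h) (p ℕ.+ s) p         ≡⟨ convSum-shift-head X s h p p ≤-refl ⟩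
  convSum X h p p                           ≡⟨ sym (shift-above s (X ⊛ h) p) ⟩
  shift s (X ⊛ h) (p ℕ.+ s) ∎
  where
  open ≡-Reasoning
  s = suc m
  tail-vanish : ∀ k → p < k → X k * shift s h (p ℕ.+ s ∸ k) ≡ 0ℤ
  tail-vanish k p<k =
    trans (cong (X k *_) (shift-below s h (m<n+o⇒m∸n<o (p ℕ.+ s) k (+-monoˡ-< s p<k)))) (*-zeroʳ (X k))

geom-below : ∀ m {n} → n < suc m → geom m n ≡ one n
geom-below m {zero}  _   = refl
geom-below m {suc b} b<m with suc m ∣? suc b
... | yes d = contradiction (∣⇒≤ d) (<⇒≱ b<m)
... | no  _ = refl

geom-periodic : ∀ m p → geom m (p ℕ.+ suc m) ≡ geom m p
geom-periodic m p with suc m ∣? p ℕ.+ suc m | suc m ∣? p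
... | yes _ | yes _  = refl
... | no  _ | no  _  = refl
... | yes d | no  nd = contradiction (∣m+n∣m⇒∣n (subst (suc m ∣_) (+-comm p (suc m)) d) ∣-refl) nd
... | no  nd | yes d = contradiction (∣m∣n⇒∣m+n d ∣-refl) nd

geom-unfold : ∀ m n → geom m n ≡ one n + shift (suc m) (geom m) n
geom-unfold m n with position (suc m) n
... | below n<s = begin
  geom m n                           ≡⟨ geom-below m n<s ⟩
  one n                              ≡⟨ sym (+-identityʳ (one n)) ⟩
  one n + 0ℤ                         ≡⟨ cong (one n +_) (sym (shift-below (suc m) (geom m) n<s)) ⟩
  one n + shift (suc m) (geom m) n ∎
  where open ≡-Reasoning
... | above p = begin
  geom m (p ℕ.+ suc m)                        ≡⟨ geom-periodic m p ⟩
  geom m p                                    ≡⟨ sym (shift-above (suc m) (geom m) p) ⟩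
  shift (suc m) (geom m) (p ℕ.+ suc m)        ≡⟨ sym (+-identityˡ _) ⟩
  0ℤ + shift (suc m) (geom m) (p ℕ.+ suc m)
    ≡⟨ cong (λ c → one c + shift (suc m) (geom m) (p ℕ.+ suc m)) (sym (+-suc p m)) ⟩
  one (p ℕ.+ suc m) + shift (suc m) (geom m) (p ℕ.+ suc m) ∎
  where open ≡-Reasoning

⊛-geom : ∀ X m n → (X ⊛ geom m) n ≡ X n + shift (suc m) (X ⊛ geom m) n
⊛-geom X m n = begin
  convSum X (geom m) n n
    ≡⟨ convSum-congʳ X (geom-unfold m) n n ⟩
  convSum X (λ a → one a + shift (suc m) (geom m) a) n n
    ≡⟨ convSum-distribʳ X one (shift (suc m) (geom m)) n n ⟩
  (X ⊛ one) n + (X ⊛ shift (suc m) (geom m)) n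
    ≡⟨ cong₂ _+_ (⊛-one X n) (⊛-shift X m (geom m) n) ⟩
  X n + shift (suc m) (X ⊛ geom m) n ∎
  where open ≡-Reasoning

⊛-geom-below : ∀ X m {n} → n < suc m → (X ⊛ geom m) n ≡ X n
⊛-geom-below X m {n} n<s =
  trans (⊛-geom X m n) (trans (cong (X n +_) (shift-below (suc m) (X ⊛ geom m) n<s)) (+-identityʳ (X n)))

⊛-geom-above : ∀ X m p {n} → p ℕ.+ suc m ≡ n → (X ⊛ geom m) n ≡ X n + (X ⊛ geom m) p
⊛-geom-above X m p refl =
  trans (⊛-geom X m (p ℕ.+ suc m)) (cong (X (p ℕ.+ suc m) +_) (shift-above (suc m) (X ⊛ geom m) p))

q-⊛ : ∀ Z n → (qser ⊛ Z) (suc n) ≡ Z n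
q-⊛ Z n = begin
  convSum qser Z (suc n) (suc n) ≡⟨ convSum-tail qser Z (suc n) {1} {suc n} (s≤′s z≤′n) higher-terms ⟩
  0ℤ * Z (suc n) + 1ℤ * Z n      ≡⟨ +-identityˡ (1ℤ * Z n) ⟩
  1ℤ * Z n                       ≡⟨ *-identityˡ (Z n) ⟩
  Z n ∎
  where
  open ≡-Reasoning
  higher-terms : ∀ k → 1 < k → qser k * Z (suc n ∸ k) ≡ 0ℤ
  higher-terms (suc zero)    (s≤s ())
  higher-terms (suc (suc _)) _ = refl

⊛-geom-nonneg : ∀ X m → Nonneg X → Nonneg (X ⊛ geom m)
⊛-geom-nonneg X m X≥0 = <-rec _ step
  where
  step : ∀ n → (∀ {y} → y < n → 0ℤ ≤ℤ (X ⊛ geom m) y) → 0ℤ ≤ℤ (X ⊛ geom m) n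
  step n ih with position (suc m) n
  ... | below n<s = subst (0ℤ ≤ℤ_) (sym (⊛-geom-below X m n<s)) (X≥0 n)
  ... | above p   = subst (0ℤ ≤ℤ_) (sym (⊛-geom-above X m p refl)) (+-mono-≤ (X≥0 (p ℕ.+ suc m)) (ih (p<p+s p m)))

-- Division by 1 - q turns a non-negative series into its (non-decreasing) partial sums.
⊛-geom₀-nondecreasing : ∀ X → Nonneg X → Nondecreasing (X ⊛ geom 0)
⊛-geom₀-nondecreasing X X≥0 n = begin
  (X ⊛ geom 0) n               ≡⟨ sym (+-identityˡ _) ⟩
  0ℤ + (X ⊛ geom 0) n          ≤⟨ +-monoˡ-≤ ((X ⊛ geom 0) n) (X≥0 (suc n)) ⟩
  X (suc n) + (X ⊛ geom 0) n   ≡⟨ sym (⊛-geom-above X 0 n (+-comm n 1)) ⟩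
  (X ⊛ geom 0) (suc n) ∎
  where open ≤-Reasoning

⊛-geom-nondecreasing : ∀ X m → Nonneg X → Nondecreasing X → Nondecreasing (X ⊛ geom m)
⊛-geom-nondecreasing X m X≥0 X↑ = <-rec _ step
  where
  Y : Series
  Y = X ⊛ geom m
  Y≥0 : Nonneg Y
  Y≥0 = ⊛-geom-nonneg X m X≥0
  step : ∀ n → (∀ {y} → y < n → Y y ≤ℤ Y (suc y)) → Y n ≤ℤ Y (suc n)
  step n ih with position (suc m) n
  ... | below n<s = begin
    Y n                                 ≡⟨ ⊛-geom-below X m n<s ⟩
    X n                                 ≤⟨ X↑ n ⟩
    X (suc n)                           ≡⟨ sym (+-identityʳ _) ⟩
    X (suc n) + 0ℤ                      ≤⟨ +-monoʳ-≤ (X (suc n)) (shift-nonneg (suc m) Y Y≥0 (suc n)) ⟩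
    X (suc n) + shift (suc m) Y (suc n) ≡⟨ sym (⊛-geom X m (suc n)) ⟩
    Y (suc n) ∎
    where open ≤-Reasoning
  ... | above p = begin
    Y (p ℕ.+ suc m)                   ≡⟨ ⊛-geom-above X m p refl ⟩
    X (p ℕ.+ suc m) + Y p             ≤⟨ +-mono-≤ (X↑ (p ℕ.+ suc m)) (ih (p<p+s p m)) ⟩
    X (suc (p ℕ.+ suc m)) + Y (suc p) ≡⟨ sym (⊛-geom-above X m (suc p) refl) ⟩
    Y (suc (p ℕ.+ suc m)) ∎
    where open ≤-Reasoning

invQPoch-nonneg : ∀ k → Nonneg (invQPoch k)
invQPoch-nonneg zero    = one-nonneg
invQPoch-nonneg (suc k) = ⊛-geom-nonneg (invQPoch k) k (invQPoch-nonneg k)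

invQ2Poch-nonneg : ∀ k → Nonneg (invQ2Poch k)
invQ2Poch-nonneg zero    = one-nonneg
invQ2Poch-nonneg (suc k) = ⊛-geom-nonneg (invQ2Poch k) (suc k) (invQ2Poch-nonneg k)

-- P_{k+1} contains the factor 1/(1-q), so its coefficients are non-decreasing.
invQPoch-nondecreasing : ∀ k → Nondecreasing (invQPoch (suc k))
invQPoch-nondecreasing zero    = ⊛-geom₀-nondecreasing one one-nonneg
invQPoch-nondecreasing (suc k) =
  ⊛-geom-nondecreasing (invQPoch (suc k)) (suc k) (invQPoch-nonneg (suc k)) (invQPoch-nondecreasing k)

invQPoch-at-0 : ∀ k → invQPoch k 0 ≡ 1ℤ
invQPoch-at-0 zero    = refl
invQPoch-at-0 (suc k) = trans (⊛-geom-below (invQPoch k) k (s≤s z≤n)) (invQPoch-at-0 k)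

invQ2Poch-at-0 : ∀ k → invQ2Poch k 0 ≡ 1ℤ
invQ2Poch-at-0 zero    = refl
invQ2Poch-at-0 (suc k) = trans (⊛-geom-below (invQ2Poch k) (suc k) (s≤s z≤n)) (invQ2Poch-at-0 k)

invQPoch-at-1 : ∀ k → invQPoch (suc k) 1 ≡ 1ℤ
invQPoch-at-1 zero    = refl
invQPoch-at-1 (suc k) = trans (⊛-geom-below (invQPoch (suc k)) (suc k) (s≤s (s≤s z≤n))) (invQPoch-at-1 k)

invQ2Poch-at-1 : ∀ k → invQ2Poch k 1 ≡ 0ℤ
invQ2Poch-at-1 zero    = refl
invQ2Poch-at-1 (suc k) = trans (⊛-geom-below (invQ2Poch k) (suc k) (s≤s (s≤s z≤n))) (invQ2Poch-at-1 k)

-- Multiplying both sides by the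
-- next factors 1/(1-q^(j+2)) resp. 1/(1-q^(j+1)) keeps the inequality, the
-- extra terms being compared through the induction hypothesis in x and the
-- monotonicity of P_{j+1}.
invQ2Poch-shifted-≤ : ∀ j x → invQ2Poch j (suc x) ≤ℤ invQPoch j x
invQ2Poch-shifted-≤ zero    x = one-nonneg x
invQ2Poch-shifted-≤ (suc j) = <-rec _ step
  where
  Q P : Series
  Q = invQ2Poch (suc j)
  P = invQPoch (suc j)
  step : ∀ x → (∀ {y} → y < x → Q (suc y) ≤ℤ P y) → Q (suc x) ≤ℤ P x
  step x ih with position (suc j) x
  ... | below x<s = begin
    Q (suc x)            ≡⟨ ⊛-geom-below (invQ2Poch j) (suc j) (s≤s x<s) ⟩
    invQ2Poch j (suc x)  ≤⟨ invQ2Poch-shifted-≤ j x ⟩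
    invQPoch j x         ≡⟨ sym (⊛-geom-below (invQPoch j) j x<s) ⟩
    P x ∎
    where open ≤-Reasoning
  ... | above p = begin
    Q (suc x)                   ≡⟨ ⊛-geom-above (invQ2Poch j) (suc j) p (+-suc p (suc j)) ⟩
    invQ2Poch j (suc x) + Q p   ≤⟨ +-mono-≤ (invQ2Poch-shifted-≤ j x) (same-index p (p<p+s p j)) ⟩
    invQPoch j x + P p          ≡⟨ sym (⊛-geom-above (invQPoch j) j p refl) ⟩
    P x ∎
    where
    open ≤-Reasoning
    same-index : ∀ p → p < x → Q p ≤ℤ P p
    same-index zero      _   = ≤ℤ-reflexive (trans (invQ2Poch-at-0 (suc j)) (sym (invQPoch-at-0 (suc j))))
    same-index (suc p') p<x = ≤ℤ-trans (ih (<⇒≤ p<x)) (invQPoch-nondecreasing j p')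

-- At the boundary exponent the comparison is strict, thanks to [q^1] P_{j+1} = 1
-- and [q^1] Q_{j+1} = 0.
invQ2Poch-boundary-< : ∀ j → invQ2Poch (suc j) (3 ℕ.+ j) + 1ℤ ≤ℤ invQPoch (suc j) (2 ℕ.+ j)
invQ2Poch-boundary-< j = begin
  invQ2Poch (suc j) (3 ℕ.+ j) + 1ℤ
    ≡⟨ cong (_+ 1ℤ) (⊛-geom-above (invQ2Poch j) (suc j) 1 refl) ⟩
  (invQ2Poch j (3 ℕ.+ j) + invQ2Poch (suc j) 1) + 1ℤ
    ≡⟨ cong (λ c → (invQ2Poch j (3 ℕ.+ j) + c) + 1ℤ) (invQ2Poch-at-1 (suc j)) ⟩
  (invQ2Poch j (3 ℕ.+ j) + 0ℤ) + 1ℤ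
    ≡⟨ cong (_+ 1ℤ) (+-identityʳ (invQ2Poch j (3 ℕ.+ j))) ⟩
  invQ2Poch j (3 ℕ.+ j) + 1ℤ
    ≤⟨ +-monoˡ-≤ 1ℤ (invQ2Poch-shifted-≤ j (2 ℕ.+ j)) ⟩
  invQPoch j (2 ℕ.+ j) + 1ℤ
    ≡⟨ cong (invQPoch j (2 ℕ.+ j) +_) (sym (invQPoch-at-1 j)) ⟩
  invQPoch j (2 ℕ.+ j) + invQPoch (suc j) 1
    ≡⟨ sym (⊛-geom-above (invQPoch j) j 1 refl) ⟩
  invQPoch (suc j) (2 ℕ.+ j) ∎
  where open ≤-Reasoning

-- Both sides carry the factor 1/(1-q^(l+3)); below the exponent l+3 the key
-- comparison applies, at l+2 the strict boundary inequality pays for the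
-- extra 1 in Q_{l+2}, and beyond that the recurrence and induction on m.
invQ2Poch-≤-quotient : ∀ l m →
  invQ2Poch (2 ℕ.+ l) (suc m) ≤ℤ (invQPoch (suc l) ⊛ geom (2 ℕ.+ l)) m
invQ2Poch-≤-quotient l = <-rec _ step
  where
  Q Q′ P Y : Series
  Q = invQ2Poch (suc l)
  Q′ = invQ2Poch (2 ℕ.+ l)
  P = invQPoch (suc l)
  Y = P ⊛ geom (2 ℕ.+ l)
  step : ∀ m → (∀ {y} → y < m → Q′ (suc y) ≤ℤ Y y) → Q′ (suc m) ≤ℤ Y m
  step m ih with position (3 ℕ.+ l) m
  ... | above p = begin
    Q′ (suc m)               ≡⟨ ⊛-geom-above Q (2 ℕ.+ l) (suc p) refl ⟩
    Q (suc m) + Q′ (suc p)   ≤⟨ +-mono-≤ (invQ2Poch-shifted-≤ (suc l) m) (ih (p<p+s p (2 ℕ.+ l))) ⟩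
    P m + Y p                ≡⟨ sym (⊛-geom-above P (2 ℕ.+ l) p refl) ⟩
    Y m ∎
    where open ≤-Reasoning
  ... | below m<s with m<1+n⇒m<n∨m≡n m<s
  ...   | inj₁ m<l+2 = begin
    Q′ (suc m)   ≡⟨ ⊛-geom-below Q (2 ℕ.+ l) (s≤s m<l+2) ⟩
    Q (suc m)    ≤⟨ invQ2Poch-shifted-≤ (suc l) m ⟩
    P m          ≡⟨ sym (⊛-geom-below P (2 ℕ.+ l) m<s) ⟩
    Y m ∎
    where open ≤-Reasoning
  ...   | inj₂ refl = begin
    Q′ (3 ℕ.+ l)         ≡⟨ ⊛-geom-above Q (2 ℕ.+ l) 0 refl ⟩
    Q (3 ℕ.+ l) + Q′ 0   ≡⟨ cong (Q (3 ℕ.+ l) +_) (invQ2Poch-at-0 (2 ℕ.+ l)) ⟩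
    Q (3 ℕ.+ l) + 1ℤ     ≤⟨ invQ2Poch-boundary-< l ⟩
    P (2 ℕ.+ l)          ≡⟨ sym (⊛-geom-below P (2 ℕ.+ l) m<s) ⟩
    Y (2 ℕ.+ l) ∎
    where open ≤-Reasoning

theorem4p1 : (L : ℕ) → 2 ≤ L → (n : ℕ) → 0ℤ ≤ℤ H L n
-- At q^0 the coefficient is 0 - (1 - 1); at q^(m+1) it is the difference of
-- the two sides of invQ2Poch-≤-quotient.
theorem4p1 (suc (suc l)) (s≤s (s≤s z≤n)) zero =
  ≤ℤ-reflexive (cong (λ c → 0ℤ - (c - 1ℤ)) (sym (invQ2Poch-at-0 (2 ℕ.+ l))))
theorem4p1 (suc (suc l)) (s≤s (s≤s z≤n)) (suc m) =
  subst (0ℤ ≤ℤ_) (sym coefficient) (i≤j⇒0≤j-i (invQ2Poch-≤-quotient l m))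
  where
  Y : Series
  Y = invQPoch (suc l) ⊛ geom (2 ℕ.+ l)
  coefficient : H (2 ℕ.+ l) (suc m) ≡ Y m - invQ2Poch (2 ℕ.+ l) (suc m)
  coefficient = cong₂ _-_ (q-⊛ Y m) (+-identityʳ (invQ2Poch (2 ℕ.+ l) (suc m)))
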